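{- Let $\theta$ and $\theta'$ be two $r$-orientations of the edges of a signed graph $\Gamma=(G,\sigma)$. Then $A(\mathcal{L}(\Gamma_\theta))$ and $A(\mathcal{L}(\Gamma_{\theta'}))$ are signature similar, and $A(S(\Gamma_\theta))$ and $A(S(\Gamma_{\theta'}))$ are signature similar.
   Context: A signed graph $\Gamma=(G,\sigma)$ consists of a finite simple graph $G$ and signature $\sigma:E(G)\to\{\pm1\}$. An $r$-orientation is a map $\theta:V(G)\times E(G)\to\{ -1,0,1\}$ with $\theta(w,uv)=0$ for $w\notin\{u,v\}$, $\theta(u,uv)\in\{\pm1\}$ for endpoints, and $\theta(u,uv)\theta(v,uv)=\sigma(uv)$. The line signed graph $\mathcal{L}(\Gamma_\theta)$ has vertex set $E(G)$; two distinct edges $a,b$ are adjacent iff they share a vertex $x$, with sign $\theta(x,a)\theta(x,b)$. The subdivision signed graph $S(\Gamma_\theta)$ is obtained by inserting a new vertex $v_e$ into each edge $e$, the edge $uv_e$ ($u$ an endpoint of $e$) having sign $\theta(u,e)$. $A(\cdot)$ is the signed adjacency matrix (entry = sign of the edge if adjacent, $0$ otherwise), with vertices ordered the same way for both orientations. Two square matrices $M,M'$ are signature similar if $M'=SMS$ for some diagonal matrix $S$ with diagonal entries in $\{\pm1\}$. -}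

module Defs where

open import Data.Nat using (ℕ)
open import Data.Fin using (Fin; _≟_)
open import Data.Integer using (ℤ; 0ℤ; 1ℤ; -1ℤ; _*_)
open import Data.Sum using (_⊎_; inj₁; inj₂)
open import Data.Product using (_×_; Σ)
open import Relation.Binary.PropositionalEquality using (_≡_; _≢_)
open import Relation.Nullary using (¬_; yes; no)

IsSign : ℤ → Set
IsSign s = s ≡ 1ℤ ⊎ s ≡ -1ℤ

-- A finite simple graph with vertex set Fin n and edge set Fin m;
-- edge e has endpoints src e and tgt e (the labelling of the two
-- endpoints is arbitrary; the graph is undirected).
record SimpleGraph (n m : ℕ) : Set where
  field
    src tgt   : Fin m → Fin n
    loopless  : ∀ e → src e ≢ tgt e
    noMulti   : ∀ e f → e ≢ f →
                ¬ (src e ≡ src f × tgt e ≡ tgt f) × ¬ (src e ≡ tgt f × tgt e ≡ src f)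
open SimpleGraph public

record SignedGraph (n m : ℕ) : Set where
  field
    graph : SimpleGraph n m
    σ     : Fin m → ℤ
    σ-sign : ∀ e → IsSign (σ e)
open SignedGraph public

Endpoint : ∀ {n m} → SimpleGraph n m → Fin n → Fin m → Set
Endpoint G w e = w ≡ src G e ⊎ w ≡ tgt G e

record IsROrientation {n m} (Γ : SignedGraph n m) (θ : Fin n → Fin m → ℤ) : Set where
  field
    off      : ∀ w e → ¬ Endpoint (graph Γ) w e → θ w e ≡ 0ℤ
    srcSign  : ∀ e → IsSign (θ (src (graph Γ) e) e)
    tgtSign  : ∀ e → IsSign (θ (tgt (graph Γ) e) e)
    product  : ∀ e → θ (src (graph Γ) e) e * θ (tgt (graph Γ) e) e ≡ σ Γ e

Matrix : Set → Set
Matrix V = V → V → ℤ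

-- M' = S M S for a diagonal ±1 matrix S (entrywise: M'ᵢⱼ = sᵢ Mᵢⱼ sⱼ).
SignatureSimilar : {V : Set} → Matrix V → Matrix V → Set
SignatureSimilar {V} M M' =
  Σ (V → ℤ) (λ s → (∀ i → IsSign (s i)) × (∀ i j → M' i j ≡ s i * M i j * s j))

-- Signed adjacency matrix of the line signed graph L(Γ_θ), vertex set E(G) = Fin m.
-- Distinct edges a, b are adjacent iff they share a vertex x (unique, as G is simple);
-- the entry is then θ(x,a) θ(x,b); otherwise (and on the diagonal) it is 0.
lineAdj : ∀ {n m} → SignedGraph n m → (Fin n → Fin m → ℤ) → Matrix (Fin m)
lineAdj Γ θ a b with a ≟ b
... | yes _ = 0ℤ
... | no _ with src (graph Γ) a ≟ src (graph Γ) b | src (graph Γ) a ≟ tgt (graph Γ) b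
              | tgt (graph Γ) a ≟ src (graph Γ) b | tgt (graph Γ) a ≟ tgt (graph Γ) b
...   | yes _ | _ | _ | _ = θ (src (graph Γ) a) a * θ (src (graph Γ) a) b
...   | no _ | yes _ | _ | _ = θ (src (graph Γ) a) a * θ (src (graph Γ) a) b
...   | no _ | no _ | yes _ | _ = θ (tgt (graph Γ) a) a * θ (tgt (graph Γ) a) b
...   | no _ | no _ | no _ | yes _ = θ (tgt (graph Γ) a) a * θ (tgt (graph Γ) a) b
...   | no _ | no _ | no _ | no _ = 0ℤ

-- Signed adjacency matrix of the subdivision signed graph S(Γ_θ),
-- vertex set V(G) ⊎ E(G) (inj₂ e is the new vertex v_e).
-- u ~ v_e iff u is an endpoint of e, with sign θ(u,e).
subdivAdj : ∀ {n m} → SignedGraph n m → (Fin n → Fin m → ℤ) → Matrix (Fin n ⊎ Fin m)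
subdivAdj Γ θ (inj₁ u) (inj₁ v) = 0ℤ
subdivAdj Γ θ (inj₂ e) (inj₂ f) = 0ℤ
subdivAdj Γ θ (inj₁ u) (inj₂ e) = incid Γ θ u e
  where
    incid : ∀ {n m} → SignedGraph n m → (Fin n → Fin m → ℤ) → Fin n → Fin m → ℤ
    incid Γ θ u e with u ≟ src (graph Γ) e | u ≟ tgt (graph Γ) e
    ... | yes _ | _ = θ u e
    ... | no _ | yes _ = θ u e
    ... | no _ | no _ = 0ℤ
subdivAdj Γ θ (inj₂ e) (inj₁ u) = subdivAdj Γ θ (inj₁ u) (inj₂ e)

{-# OPTIONS --safe #-}
-- Two r-orientations with the same signature can only differ, at each edge e, by a common
-- sign ε e = θ(u,e) θ'(u,e) at both endpoints, because θ(u,e) θ(v,e) = σ e is fixed and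
-- signs are their own inverses. Switching every edge e by a sign ε e conjugates the line
-- adjacency matrix by diag ε and the subdivision adjacency matrix by diag (1, ε).
module Submission where

open import Defs
open import Data.Fin using (Fin; _≟_)
open import Data.Integer using (ℤ; 0ℤ; 1ℤ; _*_)
open import Data.Integer.Properties using (*-zeroˡ; *-zeroʳ; *-identityˡ; *-identityʳ)
open import Data.Integer.Tactic.RingSolver using (solve-∀)
open import Data.Product using (_×_; _,_)
open import Data.Sum using (_⊎_; inj₁; inj₂; [_,_])
open import Function using (const)
open import Relation.Nullary using (¬_; yes; no)
open import Relation.Binary.PropositionalEquality
  using (_≡_; refl; sym; trans; cong; cong₂; module ≡-Reasoning)

open ≡-Reasoning

IsSign-* : ∀ {a b} → IsSign a → IsSign b → IsSign (a * b)
IsSign-* (inj₁ refl) (inj₁ refl) = inj₁ refl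
IsSign-* (inj₁ refl) (inj₂ refl) = inj₂ refl
IsSign-* (inj₂ refl) (inj₁ refl) = inj₂ refl
IsSign-* (inj₂ refl) (inj₂ refl) = inj₁ refl

IsSign⇒*-self≡1 : ∀ {a} → IsSign a → a * a ≡ 1ℤ
IsSign⇒*-self≡1 (inj₁ refl) = refl
IsSign⇒*-self≡1 (inj₂ refl) = refl

sign-rescale : ∀ {a} a' → IsSign a → a' ≡ a * a' * a
sign-rescale {a} a' a± = begin
  a'            ≡⟨ sym (*-identityʳ a') ⟩
  a' * 1ℤ       ≡⟨ cong (a' *_) (sym (IsSign⇒*-self≡1 a±)) ⟩
  a' * (a * a)  ≡⟨ reorder a a' ⟩
  a * a' * a    ∎
  where
  reorder : ∀ x y → y * (x * x) ≡ x * y * x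
  reorder = solve-∀

*-cofactor-rescale : ∀ {a b a' b'} → IsSign a' → a * b ≡ a' * b' → b' ≡ a * a' * b
*-cofactor-rescale {a} {b} {a'} {b'} a'± ab≡a'b' = begin
  b'               ≡⟨ sym (*-identityˡ b') ⟩
  1ℤ * b'          ≡⟨ cong (_* b') (sym (IsSign⇒*-self≡1 a'±)) ⟩
  a' * a' * b'     ≡⟨ reassoc a' b' ⟩
  a' * (a' * b')   ≡⟨ cong (a' *_) (sym ab≡a'b') ⟩
  a' * (a * b)     ≡⟨ reorder a b a' ⟩
  a * a' * b       ∎
  where
  reassoc : ∀ x y → x * x * y ≡ x * (x * y)
  reassoc = solve-∀
  reorder : ∀ x y z → z * (x * y) ≡ x * z * y
  reorder = solve-∀

0≡conj : ∀ x y → 0ℤ ≡ x * 0ℤ * y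
0≡conj x y = sym (trans (cong (_* y) (*-zeroʳ x)) (*-zeroˡ y))

IsSwitching : ∀ {n m} → (Fin m → ℤ) → (θ θ' : Fin n → Fin m → ℤ) → Set
IsSwitching ε θ θ' = ∀ w e → θ' w e ≡ ε e * θ w e

vertexEdgeSigns : ∀ {n m} → (Fin m → ℤ) → Fin n ⊎ Fin m → ℤ
vertexEdgeSigns ε = [ const 1ℤ , ε ]

vertexEdgeSigns-sign : ∀ {n m} {ε : Fin m → ℤ} → (∀ e → IsSign (ε e)) →
                       ∀ i → IsSign (vertexEdgeSigns {n} ε i)
vertexEdgeSigns-sign ε± (inj₁ _) = inj₁ refl
vertexEdgeSigns-sign ε± (inj₂ e) = ε± e

module _ {n m} (Γ : SignedGraph n m) where

  private
    G : SimpleGraph n m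
    G = graph Γ

  module _ {θ θ' : Fin n → Fin m → ℤ} (o : IsROrientation Γ θ) (o' : IsROrientation Γ θ') where
    open IsROrientation

    orientationRatio : Fin m → ℤ
    orientationRatio e = θ (src G e) e * θ' (src G e) e

    orientationRatio-sign : ∀ e → IsSign (orientationRatio e)
    orientationRatio-sign e = IsSign-* (srcSign o e) (srcSign o' e)

    orientations-differ-by-switching : IsSwitching orientationRatio θ θ'
    orientations-differ-by-switching w e with w ≟ src G e | w ≟ tgt G e
    ... | yes refl | _        = sign-rescale (θ' w e) (srcSign o e)
    ... | no _     | yes refl =
      *-cofactor-rescale {a = θ (src G e) e} (srcSign o' e)
                         (trans (product o e) (sym (product o' e)))
    ... | no w≢u   | no w≢v   = begin
      θ' w e                     ≡⟨ off o' w e w∉e ⟩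
      0ℤ                         ≡⟨ sym (*-zeroʳ (orientationRatio e)) ⟩
      orientationRatio e * 0ℤ    ≡⟨ cong (orientationRatio e *_) (sym (off o w e w∉e)) ⟩
      orientationRatio e * θ w e ∎
      where
      w∉e : ¬ Endpoint G w e
      w∉e (inj₁ w≡u) = w≢u w≡u
      w∉e (inj₂ w≡v) = w≢v w≡v

  module _ (ε : Fin m → ℤ) {θ θ' : Fin n → Fin m → ℤ} (sw : IsSwitching ε θ θ') where

    private
      product-switch : ∀ w a b → θ' w a * θ' w b ≡ ε a * (θ w a * θ w b) * ε b
      product-switch w a b = begin
        θ' w a * θ' w b                   ≡⟨ cong₂ _*_ (sw w a) (sw w b) ⟩
        ε a * θ w a * (ε b * θ w b)       ≡⟨ reorder (ε a) (ε b) (θ w a) (θ w b) ⟩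
        ε a * (θ w a * θ w b) * ε b       ∎
        where
        reorder : ∀ x y u v → x * u * (y * v) ≡ x * (u * v) * y
        reorder = solve-∀

    lineAdj-switch : ∀ a b → lineAdj Γ θ' a b ≡ ε a * lineAdj Γ θ a b * ε b
    lineAdj-switch a b with a ≟ b
    ... | yes _ = 0≡conj (ε a) (ε b)
    ... | no _ with src G a ≟ src G b | src G a ≟ tgt G b | tgt G a ≟ src G b | tgt G a ≟ tgt G b
    ...   | yes _ | _     | _     | _     = product-switch (src G a) a b
    ...   | no _  | yes _ | _     | _     = product-switch (src G a) a b
    ...   | no _  | no _  | yes _ | _     = product-switch (tgt G a) a b
    ...   | no _  | no _  | no _  | yes _ = product-switch (tgt G a) a b
    ...   | no _  | no _  | no _  | no _  = 0≡conj (ε a) (ε b)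

    incidence-switch : ∀ u e →
      subdivAdj Γ θ' (inj₁ u) (inj₂ e) ≡ ε e * subdivAdj Γ θ (inj₁ u) (inj₂ e)
    incidence-switch u e with u ≟ src G e | u ≟ tgt G e
    ... | yes _ | _     = sw u e
    ... | no _  | yes _ = sw u e
    ... | no _  | no _  = sym (*-zeroʳ (ε e))

    subdivAdj-switch : ∀ i j → subdivAdj Γ θ' i j
                             ≡ vertexEdgeSigns ε i * subdivAdj Γ θ i j * vertexEdgeSigns ε j
    subdivAdj-switch (inj₁ u) (inj₁ v) = refl
    subdivAdj-switch (inj₂ e) (inj₂ f) = 0≡conj (ε e) (ε f)
    subdivAdj-switch (inj₁ u) (inj₂ e) = begin
      subdivAdj Γ θ' (inj₁ u) (inj₂ e)        ≡⟨ incidence-switch u e ⟩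
      ε e * subdivAdj Γ θ (inj₁ u) (inj₂ e)   ≡⟨ reorder (ε e) (subdivAdj Γ θ (inj₁ u) (inj₂ e)) ⟩
      1ℤ * subdivAdj Γ θ (inj₁ u) (inj₂ e) * ε e ∎
      where
      reorder : ∀ x y → x * y ≡ 1ℤ * y * x
      reorder = solve-∀
    subdivAdj-switch (inj₂ e) (inj₁ u) = begin
      subdivAdj Γ θ' (inj₁ u) (inj₂ e)        ≡⟨ incidence-switch u e ⟩
      ε e * subdivAdj Γ θ (inj₁ u) (inj₂ e)   ≡⟨ sym (*-identityʳ _) ⟩
      ε e * subdivAdj Γ θ (inj₁ u) (inj₂ e) * 1ℤ ∎

lemma2p5 : ∀ {n m} (Γ : SignedGraph n m) (θ θ' : Fin n → Fin m → ℤ) →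
           IsROrientation Γ θ → IsROrientation Γ θ' →
           SignatureSimilar (lineAdj Γ θ) (lineAdj Γ θ')
           × SignatureSimilar (subdivAdj Γ θ) (subdivAdj Γ θ')
lemma2p5 {m = m} Γ θ θ' o o' =
  (ε , ε± , lineAdj-switch Γ ε sw) ,
  (vertexEdgeSigns ε , vertexEdgeSigns-sign ε± , subdivAdj-switch Γ ε sw)
  where
  ε : Fin m → ℤ
  ε = orientationRatio Γ o o'
  ε± : ∀ e → IsSign (ε e)
  ε± = orientationRatio-sign Γ o o'
  sw : IsSwitching ε θ θ'
  sw = orientations-differ-by-switching Γ o o'
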